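{- Let $\Pi_q$ be a projective plane of order $q$ and $3\le r\le q+1$. If $k\le r-1$ and $A\subseteq\bigcup_{i=1}^k l_i$ for some lines $l_1,\dots,l_k$ of $\Pi_q$, then $A$ does not percolate in $r$-neighbor line percolation.
   Context: A finite projective plane $\Pi_q$ of order $q\ge 2$ has $q^2+q+1$ points and $q^2+q+1$ lines; every line contains $q+1$ points, every point lies on $q+1$ lines, any two lines meet in exactly one point and any two points lie on exactly one line. $r$-neighbor line percolation: for a set $A$ of points let $A^0=A$ and for $s\ge1$ let $A^s=A^{s-1}\cup\{P: \exists \text{ line } l\ni P \text{ with } |l\cap A^{s-1}|\ge r\}$; the closure of $A$ is the stable set $A^k=A^{k+1}$, and $A$ percolates if its closure is the whole point set. -}

module Defs where

open import Data.Nat using (ℕ; zero; suc; _+_; _*_; _≤_; _≤ᵇ_)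
open import Data.Bool using (Bool; true; false; _∨_; _∧_)
open import Data.Fin using (Fin; zero; suc)
open import Data.Vec using (tabulate; lookup)
open import Data.Fin.Subset using (Subset; _∈_; _∩_; ∣_∣)
open import Data.Product using (∃; Σ; _×_)
open import Relation.Binary.PropositionalEquality using (_≡_; _≢_)

nPts : ℕ → ℕ
nPts q = q * q + q + 1

record ProjectivePlane (q : ℕ) : Set where
  field
    inc : Fin (nPts q) → Fin (nPts q) → Bool
  pointsOn : Fin (nPts q) → Subset (nPts q)
  pointsOn l = tabulate (λ P → inc P l)
  linesThrough : Fin (nPts q) → Subset (nPts q)
  linesThrough P = tabulate (λ l → inc P l)
  field
    lineSize    : ∀ l → ∣ pointsOn l ∣ ≡ suc q
    pointDegree : ∀ P → ∣ linesThrough P ∣ ≡ suc q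
    linesMeet   : ∀ l m → l ≢ m → ∣ pointsOn l ∩ pointsOn m ∣ ≡ 1
    pointsJoin  : ∀ P Q → P ≢ Q → ∣ linesThrough P ∩ linesThrough Q ∣ ≡ 1

anyFin : ∀ {n} → (Fin n → Bool) → Bool
anyFin {zero}  f = false
anyFin {suc n} f = f zero ∨ anyFin (λ i → f (suc i))

module Percolation {q : ℕ} (Π : ProjectivePlane q) (r : ℕ) where
  open ProjectivePlane Π

  step : Subset (nPts q) → Subset (nPts q)
  step S = tabulate (λ P → lookup S P ∨
             anyFin (λ l → inc P l ∧ (r ≤ᵇ ∣ pointsOn l ∩ S ∣)))

  iter : ℕ → Subset (nPts q) → Subset (nPts q)
  iter zero    A = A
  iter (suc s) A = step (iter s A)

  -- A percolates: the (eventually stable) closure is the whole point set,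
  -- i.e. some A^s contains every point.
  Percolates : Subset (nPts q) → Set
  Percolates A = ∃ λ s → ∀ P → P ∈ iter s A

module Submission where

-- The union C of the lines l₁, …, l_k is closed under a percolation step: a line
-- l outside the family meets each lᵢ in exactly one point, so |l ∩ C| ≤ k < r and
-- l never fires, while a line of the family only adds points of C. Hence every Aˢ
-- stays inside C, and C is not the whole plane because
-- |C| ≤ k(q + 1) ≤ q(q + 1) < q² + q + 1.

open import Defs
open import Data.Nat using (ℕ; zero; suc; _+_; _*_; _∸_; _≤_; _<_; s≤s)
open import Data.Nat.Properties
  using (≤-refl; ≤-trans; ≤-reflexive; ≤-pred; <-≤-trans; ≤-<-trans; <⇒≱; +-suc; +-comm;
         +-mono-≤; *-monoˡ-≤; *-suc; *-identityʳ; m<m+n; n≤1+n; ≤ᵇ⇒≤)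
open import Data.Bool using (Bool; true; false; _∨_; _∧_)
open import Data.Bool.Properties using (T-≡)
open import Data.Fin using (Fin; zero; suc)
open import Data.Fin.Properties using (_≟_; any?)
open import Data.Fin.Subset using (Subset; _∈_; _∩_; _∪_; ∣_∣; ⊥; ⊤; inside; outside)
open import Data.Fin.Subset.Properties
  using (p⊆q⇒∣p∣≤∣q∣; x∈p∩q⁺; x∈p∩q⁻; x∈p∪q⁺; ∣⊥∣≡0; ∣⊤∣≡n)
open import Data.Vec using (_∷_; []; lookup; tabulate)
open import Data.Vec.Properties using (lookup∘tabulate; []=⇒lookup; lookup⇒[]=)
open import Data.Product using (∃; _,_; _×_; map₂)
open import Data.Sum using (_⊎_; inj₁; inj₂)
open import Data.Empty using (⊥-elim)
open import Function.Bundles using (Equivalence)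
open import Relation.Binary.PropositionalEquality using (_≡_; _≢_; refl; sym; trans; subst; ≢-sym)
open import Relation.Nullary using (¬_; yes; no)

∣p∪q∣≤∣p∣+∣q∣ : ∀ {n} (p q : Subset n) → ∣ p ∪ q ∣ ≤ ∣ p ∣ + ∣ q ∣
∣p∪q∣≤∣p∣+∣q∣ []            []            = ≤-refl
∣p∪q∣≤∣p∣+∣q∣ (outside ∷ p) (outside ∷ q) = ∣p∪q∣≤∣p∣+∣q∣ p q
∣p∪q∣≤∣p∣+∣q∣ (inside  ∷ p) (outside ∷ q) = s≤s (∣p∪q∣≤∣p∣+∣q∣ p q)
∣p∪q∣≤∣p∣+∣q∣ (outside ∷ p) (inside  ∷ q) =
  subst (suc ∣ p ∪ q ∣ ≤_) (sym (+-suc ∣ p ∣ ∣ q ∣)) (s≤s (∣p∪q∣≤∣p∣+∣q∣ p q))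
∣p∪q∣≤∣p∣+∣q∣ (inside  ∷ p) (inside  ∷ q) =
  s≤s (≤-trans (∣p∪q∣≤∣p∣+∣q∣ p q)
               (subst (∣ p ∣ + ∣ q ∣ ≤_) (sym (+-suc ∣ p ∣ ∣ q ∣)) (n≤1+n _)))

⋃ᶠ : ∀ {n k} → (Fin k → Subset n) → Subset n
⋃ᶠ {k = zero}  f = ⊥
⋃ᶠ {k = suc k} f = f zero ∪ ⋃ᶠ (λ i → f (suc i))

x∈⋃ᶠ⁺ : ∀ {n k} (f : Fin k → Subset n) {x} i → x ∈ f i → x ∈ ⋃ᶠ f
x∈⋃ᶠ⁺ f zero    x∈fi = x∈p∪q⁺ (inj₁ x∈fi)
x∈⋃ᶠ⁺ f (suc i) x∈fi = x∈p∪q⁺ (inj₂ (x∈⋃ᶠ⁺ (λ j → f (suc j)) i x∈fi))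

∣⋃ᶠ∣≤k*c : ∀ {n k c} (f : Fin k → Subset n) → (∀ i → ∣ f i ∣ ≤ c) → ∣ ⋃ᶠ f ∣ ≤ k * c
∣⋃ᶠ∣≤k*c {n} {zero}  f _     = ≤-reflexive (∣⊥∣≡0 n)
∣⋃ᶠ∣≤k*c {k = suc k} f ∣fi∣≤c =
  ≤-trans (∣p∪q∣≤∣p∣+∣q∣ (f zero) _)
          (+-mono-≤ (∣fi∣≤c zero) (∣⋃ᶠ∣≤k*c (λ i → f (suc i)) (λ i → ∣fi∣≤c (suc i))))

covered⇒∣p∣≤k*c : ∀ {n k c} (f : Fin k → Subset n) {p : Subset n} →
                  (∀ {x} → x ∈ p → ∃ λ i → x ∈ f i) → (∀ i → ∣ f i ∣ ≤ c) → ∣ p ∣ ≤ k * c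
covered⇒∣p∣≤k*c f covered ∣fi∣≤c =
  ≤-trans (p⊆q⇒∣p∣≤∣q∣ (λ x∈p → let i , x∈fi = covered x∈p in x∈⋃ᶠ⁺ f i x∈fi))
          (∣⋃ᶠ∣≤k*c f ∣fi∣≤c)

x∈tabulate⁻ : ∀ {n} (g : Fin n → Bool) {x} → x ∈ tabulate g → g x ≡ true
x∈tabulate⁻ g {x} x∈ = trans (sym (lookup∘tabulate g x)) ([]=⇒lookup x∈)

x∈tabulate⁺ : ∀ {n} (g : Fin n → Bool) {x} → g x ≡ true → x ∈ tabulate g
x∈tabulate⁺ g {x} gx = lookup⇒[]= x (tabulate g) (trans (lookup∘tabulate g x) gx)

∨-true⁻ : ∀ a {b} → a ∨ b ≡ true → a ≡ true ⊎ b ≡ true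
∨-true⁻ true  _ = inj₁ refl
∨-true⁻ false b = inj₂ b

∧-true⁻ : ∀ a {b} → a ∧ b ≡ true → a ≡ true × b ≡ true
∧-true⁻ true b = refl , b

anyFin-true⁻ : ∀ {n} (f : Fin n → Bool) → anyFin f ≡ true → ∃ λ i → f i ≡ true
anyFin-true⁻ {suc n} f any with ∨-true⁻ (f zero) any
... | inj₁ f0 = zero , f0
... | inj₂ rest = let i , fi = anyFin-true⁻ (λ i → f (suc i)) rest in suc i , fi

k*[1+q]<nPts : ∀ {k q} → k ≤ q → k * suc q < nPts q
k*[1+q]<nPts {k} {q} k≤q = ≤-<-trans (*-monoˡ-≤ (suc q) k≤q) q*[1+q]<nPts
  where
  q*[1+q]<nPts : q * suc q < nPts q
  q*[1+q]<nPts = subst (_< nPts q) (sym (trans (*-suc q q) (+-comm q (q * q))))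
                       (m<m+n (q * q + q) (s≤s ≤-refl))

module _ {q : ℕ} (Π : ProjectivePlane q) where
  open ProjectivePlane Π

  CoveredBy : ∀ {k} → (Fin k → Fin (nPts q)) → Subset (nPts q) → Set
  CoveredBy ls S = ∀ {P} → P ∈ S → ∃ λ i → P ∈ pointsOn (ls i)

  ∣covered∣≤k*[1+q] : ∀ {k} (ls : Fin k → Fin (nPts q)) {S} → CoveredBy ls S → ∣ S ∣ ≤ k * suc q
  ∣covered∣≤k*[1+q] ls covered =
    covered⇒∣p∣≤k*c (λ i → pointsOn (ls i)) covered (λ i → ≤-reflexive (lineSize (ls i)))

  few-lines-do-not-cover : ∀ {k} (ls : Fin k → Fin (nPts q)) → k ≤ q → ¬ CoveredBy ls ⊤
  few-lines-do-not-cover {k} ls k≤q covered = <⇒≱ (k*[1+q]<nPts k≤q)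
    (subst (_≤ k * suc q) (∣⊤∣≡n (nPts q)) (∣covered∣≤k*[1+q] ls covered))

  ∣line∩covered∣≤k : ∀ {k} (ls : Fin k → Fin (nPts q)) {l S} →
                     (∀ i → ls i ≢ l) → CoveredBy ls S → ∣ pointsOn l ∩ S ∣ ≤ k
  ∣line∩covered∣≤k {k} ls {l} {S} l∉ls covered =
    subst (_ ≤_) (*-identityʳ k) (covered⇒∣p∣≤k*c meets covered-by-meets ∣meets∣≤1)
    where
    meets : Fin k → Subset (nPts q)
    meets i = pointsOn l ∩ pointsOn (ls i)
    covered-by-meets : ∀ {P} → P ∈ pointsOn l ∩ S → ∃ λ i → P ∈ meets i
    covered-by-meets P∈l∩S with x∈p∩q⁻ (pointsOn l) S P∈l∩S
    ... | P∈l , P∈S = map₂ (λ P∈li → x∈p∩q⁺ (P∈l , P∈li)) (covered P∈S)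
    ∣meets∣≤1 : ∀ i → ∣ meets i ∣ ≤ 1
    ∣meets∣≤1 i = ≤-reflexive (linesMeet l (ls i) (≢-sym (l∉ls i)))

  module _ (r : ℕ) where
    open Percolation Π r

    x∈step⁻ : ∀ {S P} → P ∈ step S →
              P ∈ S ⊎ ∃ λ l → P ∈ pointsOn l × r ≤ ∣ pointsOn l ∩ S ∣
    x∈step⁻ {S} {P} P∈step with ∨-true⁻ (lookup S P) (x∈tabulate⁻ _ P∈step)
    ... | inj₁ P∈S = inj₁ (lookup⇒[]= P S P∈S)
    ... | inj₂ fires with anyFin-true⁻ _ fires
    ... | l , P∈l∧rich with ∧-true⁻ (inc P l) P∈l∧rich
    ... | P∈l , rich =
      inj₂ (l , x∈tabulate⁺ _ P∈l , ≤ᵇ⇒≤ r _ (Equivalence.from T-≡ rich))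

    step-preserves-CoveredBy : ∀ {k} (ls : Fin k → Fin (nPts q)) → k < r →
                               ∀ {S} → CoveredBy ls S → CoveredBy ls (step S)
    step-preserves-CoveredBy ls k<r covered P∈step with x∈step⁻ P∈step
    ... | inj₁ P∈S = covered P∈S
    ... | inj₂ (l , P∈l , r≤∣l∩S∣) with any? (λ i → ls i ≟ l)
    ... | yes (i , refl) = i , P∈l
    ... | no l∉ls = ⊥-elim (<⇒≱ (<-≤-trans k<r r≤∣l∩S∣)
                                (∣line∩covered∣≤k ls (λ i li≡l → l∉ls (i , li≡l)) covered))

    iter-preserves-CoveredBy : ∀ {k} (ls : Fin k → Fin (nPts q)) → k < r →
                               ∀ {A} → CoveredBy ls A → ∀ s → CoveredBy ls (iter s A)
    iter-preserves-CoveredBy ls k<r covered zero    = covered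
    iter-preserves-CoveredBy ls k<r covered (suc s) =
      step-preserves-CoveredBy ls k<r (iter-preserves-CoveredBy ls k<r covered s)

proposition2 : (q : ℕ) → 2 ≤ q → (Π : ProjectivePlane q) → (r : ℕ) → 3 ≤ r → r ≤ suc q →
    (k : ℕ) → k ≤ r ∸ 1 → (ls : Fin k → Fin (nPts q)) → (A : Subset (nPts q)) →
    (∀ P → P ∈ A → ∃ λ i → ProjectivePlane.inc Π P (ls i) ≡ true) →
    ¬ Percolation.Percolates Π r A
proposition2 _ _ _ zero () _ _ _ _ _ _
proposition2 q _ Π (suc r) _ 1+r≤1+q k k≤r ls A A⊆lines (s , percolates) =
  few-lines-do-not-cover Π ls (≤-trans k≤r (≤-pred 1+r≤1+q))
    (λ _ → closureCovered (percolates _))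
  where
  closureCovered : CoveredBy Π ls (Percolation.iter Π (suc r) s A)
  closureCovered = iter-preserves-CoveredBy Π (suc r) ls (s≤s k≤r)
    (λ P∈A → map₂ (x∈tabulate⁺ _) (A⊆lines _ P∈A)) s
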